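{- Let $p:\mathbb E\to\mathbb B$ be a posetal fibration with fibred small limits and $\mathcal T$ a monad on $\mathbb B$. For any class $V$ and any cone $r=\{r_X:V\to\mathbf{Cls}(\mathcal T,X)\}_{X\in\mathbb E}$ from $V$ over $\mathbf{Cls}(\mathcal T,-):\mathbf{Split}(\mathbb E)^{op}\to\mathbf{Set}$ satisfying the $\phi$-inequality, there exists a unique function $m:V\to\mathbf{Lift}(\mathcal T)$ such that $r_X=q_X\circ m$ for all $X\in\mathbb E$.
   Context: $p$ posetal: fibres are posets; $p$ faithful, $\mathbb E(X,Y)\subseteq\mathbb B(pX,pY)$; fibres have arbitrary meets. $\mathcal T=(T,\eta,\mu)$, $f^\#=\mu\circ Tf$. $\mathbf{Lift}(\mathcal T)$: class of liftings of $\mathcal T$ along $p$ (monads on $\mathbb E$ with $p\dot T=Tp$, $p\dot\eta=\eta p$, $p\dot\mu=\mu p$), ordered pointwise and with pointwise meets. For $R\in\mathbb B$, $S\in\mathbb E_{TR}$, $[S]^R\in\mathbf{Lift}(\mathcal T)$ is the (pointwise) codensity lifting with single parameter $(R,S)$, with $[S]^RY=\bigwedge_{f\in\mathbb E(Y,S)}(f^\#)^{ -1}(S)$. $\mathbf{Cls}(\mathcal T,X)=\{S\in\mathbb E_{T(pX)}\mid S=[S]^{pX}X\}$, ordered as in the fibre; $q_X(\dot T)=\dot TX$; $\phi_{X,Y}:\mathbf{Cls}(\mathcal T,X)\to\mathbf{Cls}(\mathcal T,Y)$, $\phi_{X,Y}(S)=[S]^{pX}Y$. $X\lhd Y$ means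 there is a split monomorphism $X\to Y$ in $\mathbb E$; $\mathbf{Split}(\mathbb E)$ is the preordered class $(\mathrm{Obj}\,\mathbb E,\lhd)$, and $\mathbf{Cls}(\mathcal T,-)$ is the functor $\mathbf{Split}(\mathbb E)^{op}\to\mathbf{Set}$ sending $X\lhd Y$ to $\phi_{Y,X}$. A cone from a class $V$ over it is a family $r_X:V\to\mathbf{Cls}(\mathcal T,X)$ with $\phi_{Y,X}\circ r_Y=r_X$ whenever $X\lhd Y$; it satisfies the $\phi$-inequality if $\phi_{Y,X}(r_Y(v))\ge r_X(v)$ for all $X,Y\in\mathbb E$ and $v\in V$. -}

module Defs where

open import Level using (Level; _⊔_) renaming (suc to lsuc)
open import Relation.Binary.Core using (Rel)
open import Relation.Binary.Structures using (IsEquivalence; IsPartialOrder)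
open import Relation.Binary.PropositionalEquality using (_≡_)
open import Data.Product using (Σ; _,_; proj₁; proj₂; _×_; ∃)

record Category (o ℓ e : Level) : Set (lsuc (o ⊔ ℓ ⊔ e)) where
  infixr 9 _∘_
  infix  4 _≈_
  field
    Obj   : Set o
    _⇒_   : Obj → Obj → Set ℓ
    _≈_   : ∀ {A B} → Rel (A ⇒ B) e
    id    : ∀ {A} → A ⇒ A
    _∘_   : ∀ {A B C} → B ⇒ C → A ⇒ B → A ⇒ C
    ≈-isEquivalence : ∀ {A B} → IsEquivalence (_≈_ {A} {B})
    ∘-resp-≈  : ∀ {A B C} {f f′ : B ⇒ C} {g g′ : A ⇒ B} →
                f ≈ f′ → g ≈ g′ → f ∘ g ≈ f′ ∘ g′
    identityˡ : ∀ {A B} {f : A ⇒ B} → id ∘ f ≈ f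
    identityʳ : ∀ {A B} {f : A ⇒ B} → f ∘ id ≈ f
    assoc     : ∀ {A B C D} {f : A ⇒ B} {g : B ⇒ C} {h : C ⇒ D} →
                (h ∘ g) ∘ f ≈ h ∘ (g ∘ f)

record Monad {o ℓ e : Level} (𝔹 : Category o ℓ e) : Set (o ⊔ ℓ ⊔ e) where
  open Category 𝔹
  field
    T₀      : Obj → Obj
    T₁      : ∀ {A B} → A ⇒ B → T₀ A ⇒ T₀ B
    T-resp-≈ : ∀ {A B} {f g : A ⇒ B} → f ≈ g → T₁ f ≈ T₁ g
    T-id    : ∀ {A} → T₁ (id {A}) ≈ id
    T-∘     : ∀ {A B C} {f : A ⇒ B} {g : B ⇒ C} → T₁ (g ∘ f) ≈ T₁ g ∘ T₁ f
    η       : ∀ {A} → A ⇒ T₀ A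
    μ       : ∀ {A} → T₀ (T₀ A) ⇒ T₀ A
    η-natural : ∀ {A B} {f : A ⇒ B} → η ∘ f ≈ T₁ f ∘ η
    μ-natural : ∀ {A B} {f : A ⇒ B} → μ ∘ T₁ (T₁ f) ≈ T₁ f ∘ μ
    μ-assoc   : ∀ {A} → μ {A} ∘ T₁ μ ≈ μ ∘ μ
    μ-unitˡ   : ∀ {A} → μ {A} ∘ T₁ η ≈ id
    μ-unitʳ   : ∀ {A} → μ {A} ∘ η ≈ id

  _# : ∀ {A B} → A ⇒ T₀ B → T₀ A ⇒ T₀ B
  f # = μ ∘ T₁ f

-- Posetal (faithful) fibrations with fibred small limits, presented as
-- their fibres (posets 𝔼_I) with (split, since fibres are posets)
-- reindexing f⁻¹ = f *_ .  An object of 𝔼 over I is an element of 𝔼_I,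
-- and a morphism X → Y of 𝔼 over f : pX → pY exists (uniquely, p faithful)
-- iff X ≤ f * Y.  Small = indexed by types of the size of the hom-sets
-- of 𝔼 (level ℓ ⊔ r).

record PosetalFibration {o ℓ e : Level} (𝔹 : Category o ℓ e) (c r : Level)
       : Set (o ⊔ lsuc ℓ ⊔ e ⊔ lsuc c ⊔ lsuc r) where
  open Category 𝔹
  infix 4 _≤_
  infixr 9 _*_
  field
    Fib  : Obj → Set c
    _≤_  : ∀ {I} → Rel (Fib I) r
    ≤-isPartialOrder : ∀ {I} → IsPartialOrder (_≡_ {A = Fib I}) _≤_
    _*_     : ∀ {I J} → I ⇒ J → Fib J → Fib I
    *-mono  : ∀ {I J} (f : I ⇒ J) {X Y : Fib J} → X ≤ Y → f * X ≤ f * Y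
    *-resp-≈ : ∀ {I J} {f g : I ⇒ J} (X : Fib J) → f ≈ g → f * X ≡ g * X
    *-id    : ∀ {I} (X : Fib I) → id * X ≡ X
    *-∘     : ∀ {I J K} (f : I ⇒ J) (g : J ⇒ K) (X : Fib K) →
              (g ∘ f) * X ≡ f * (g * X)
    ⋀        : ∀ {I} {A : Set (ℓ ⊔ r)} → (A → Fib I) → Fib I
    ⋀-lower  : ∀ {I} {A : Set (ℓ ⊔ r)} (F : A → Fib I) (a : A) → ⋀ F ≤ F a
    ⋀-greatest : ∀ {I} {A : Set (ℓ ⊔ r)} (F : A → Fib I) (Z : Fib I) →
                 (∀ a → Z ≤ F a) → Z ≤ ⋀ F
    *-⋀ : ∀ {I J} (f : I ⇒ J) {A : Set (ℓ ⊔ r)} (F : A → Fib J) →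
          f * ⋀ F ≡ ⋀ (λ a → f * F a)

module Lifting {o ℓ e c r : Level} {𝔹 : Category o ℓ e}
               (P : PosetalFibration 𝔹 c r) (𝒯 : Monad 𝔹) where
  open Category 𝔹
  open PosetalFibration P
  open Monad 𝒯

  EObj : Set (o ⊔ c)
  EObj = Σ Obj Fib

  p : EObj → Obj
  p = proj₁

  EHom : EObj → EObj → Set (ℓ ⊔ r)
  EHom (I , X) (J , Y) = Σ (I ⇒ J) (λ f → X ≤ f * Y)

  -- A lifting of 𝒯 along p: a monad (Ṫ, η̇, μ̇) on 𝔼 with pṪ = Tp,
  -- pη̇ = ηp, pμ̇ = μp.  Since p is faithful, such a monad is determined by
  -- its object part, subject to Tf, η, μ being morphisms of 𝔼
  -- (functor and monad laws are then automatic).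
  record Lift : Set (o ⊔ ℓ ⊔ c ⊔ r) where
    field
      Ṫ     : ∀ {I} → Fib I → Fib (T₀ I)
      Ṫ-hom : ∀ {I J} {X : Fib I} {Y : Fib J} (f : I ⇒ J) →
              X ≤ f * Y → Ṫ X ≤ T₁ f * Ṫ Y
      η-hom : ∀ {I} (X : Fib I) → X ≤ η * Ṫ X
      μ-hom : ∀ {I} (X : Fib I) → Ṫ (Ṫ X) ≤ μ * Ṫ X

  q : (X : EObj) → Lift → Fib (T₀ (p X))
  q (I , X) L = Lift.Ṫ L X

  codensity : ∀ (R : Obj) (S : Fib (T₀ R)) (Y : EObj) → Fib (T₀ (p Y))
  codensity R S (J , Y) = ⋀ {A = Σ (J ⇒ T₀ R) (λ f → Y ≤ f * S)}
                            (λ fp → (proj₁ fp #) * S)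

  Cls : EObj → Set c
  Cls X = Σ (Fib (T₀ (p X))) (λ S → S ≡ codensity (p X) S X)

  φ : (X Y : EObj) → Cls X → Fib (T₀ (p Y))
  φ X Y S = codensity (p X) (proj₁ S) Y

  _◁_ : EObj → EObj → Set (ℓ ⊔ e ⊔ r)
  X ◁ Y = Σ (EHom X Y) λ s → Σ (EHom Y X) λ t → proj₁ t ∘ proj₁ s ≈ id

  IsCone : ∀ {v} {V : Set v} → ((X : EObj) → V → Cls X) → Set (o ⊔ ℓ ⊔ e ⊔ c ⊔ r ⊔ v)
  IsCone {V = V} rr = ∀ (X Y : EObj) → X ◁ Y → ∀ (x : V) →
                      φ Y X (rr Y x) ≡ proj₁ (rr X x)

  PhiInequality : ∀ {v} {V : Set v} → ((X : EObj) → V → Cls X) → Set (o ⊔ c ⊔ r ⊔ v)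
  PhiInequality {V = V} rr = ∀ (X Y : EObj) (x : V) →
                             proj₁ (rr X x) ≤ φ Y X (rr Y x)

  Factors : ∀ {v} {V : Set v} → ((X : EObj) → V → Cls X) → (V → Lift) →
            Set (o ⊔ c ⊔ v)
  Factors {V = V} rr m = ∀ (X : EObj) (x : V) → proj₁ (rr X x) ≡ q X (m x)

-- A family S_X ∈ Cls(𝒯, X) is already the object part of a lifting as soon as
-- S_X ≤ [S_Y]^{pY} X for all X, Y.  Lifting a base morphism f : X → Y
-- follows by taking the test map η ∘ f into S_Y (whose Kleisli extension is
-- T f), and lifting μ by taking the test map id from S_X into S_X (whose
-- extension is μ); the unit is lifted by any closed object, because every
-- test map g into S factors as g^# ∘ η.  Applying this to r(v) for each v
-- gives m; uniqueness holds since a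
-- lifting is determined by its values q_X.
module Submission where

open import Defs
open import Level using (Level)
open import Data.Product using (Σ; _×_; _,_; proj₁; proj₂)
open import Relation.Binary.Bundles using (Setoid; Poset)
open import Relation.Binary.PropositionalEquality using (_≡_; refl; sym; trans; subst)
import Relation.Binary.Reasoning.PartialOrder as PosetReasoning
import Relation.Binary.Reasoning.Setoid as SetoidReasoning

module KleisliProperties {o ℓ e : Level} {𝔹 : Category o ℓ e} (𝒯 : Monad 𝔹) where
  open Category 𝔹
  open Monad 𝒯

  hom-setoid : Obj → Obj → Setoid ℓ e
  hom-setoid A B = record { isEquivalence = ≈-isEquivalence {A} {B} }

  module ≈ {A B} = Setoid (hom-setoid A B)

  #-∘-η : ∀ {A B} (g : A ⇒ T₀ B) → (g #) ∘ η ≈ g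
  #-∘-η {A} {B} g = begin
    (μ ∘ T₁ g) ∘ η   ≈⟨ assoc ⟩
    μ ∘ (T₁ g ∘ η)   ≈⟨ ∘-resp-≈ ≈.refl η-natural ⟨
    μ ∘ (η ∘ g)      ≈⟨ assoc ⟨
    (μ ∘ η) ∘ g      ≈⟨ ∘-resp-≈ μ-unitʳ ≈.refl ⟩
    id ∘ g           ≈⟨ identityˡ ⟩
    g                ∎
    where open SetoidReasoning (hom-setoid A (T₀ B))

  η-∘-#≈T₁ : ∀ {A B} (f : A ⇒ B) → ((η ∘ f) #) ≈ T₁ f
  η-∘-#≈T₁ {A} {B} f = begin
    μ ∘ T₁ (η ∘ f)      ≈⟨ ∘-resp-≈ ≈.refl T-∘ ⟩
    μ ∘ (T₁ η ∘ T₁ f)   ≈⟨ assoc ⟨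
    (μ ∘ T₁ η) ∘ T₁ f   ≈⟨ ∘-resp-≈ μ-unitˡ ≈.refl ⟩
    id ∘ T₁ f           ≈⟨ identityˡ ⟩
    T₁ f                ∎
    where open SetoidReasoning (hom-setoid (T₀ A) (T₀ B))

  id-#≈μ : ∀ {A} → (id {T₀ A} #) ≈ μ
  id-#≈μ = ≈.trans (∘-resp-≈ ≈.refl T-id) identityʳ

module FibreProperties {o ℓ e c r : Level} {𝔹 : Category o ℓ e}
                       (P : PosetalFibration 𝔹 c r) where
  open Category 𝔹
  open PosetalFibration P

  fibre-poset : Obj → Poset c c r
  fibre-poset I = record { isPartialOrder = ≤-isPartialOrder {I} }

  *-resp-≈-≤ : ∀ {I J} {f g : I ⇒ J} (X : Fib J) → f ≈ g → f * X ≤ g * X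
  *-resp-≈-≤ {I} X f≈g = Poset.reflexive (fibre-poset I) (*-resp-≈ X f≈g)

module CodensityProperties {o ℓ e c r : Level} {𝔹 : Category o ℓ e}
                           (P : PosetalFibration 𝔹 c r) (𝒯 : Monad 𝔹) where
  open Category 𝔹
  open PosetalFibration P
  open Monad 𝒯
  open Lifting P 𝒯
  open KleisliProperties 𝒯
  open FibreProperties P

  codensity-lower : ∀ {R J} (S : Fib (T₀ R)) {Y : Fib J} (g : J ⇒ T₀ R) →
                    Y ≤ g * S → codensity R S (J , Y) ≤ (g #) * S
  codensity-lower S g Y≤g*S = ⋀-lower _ (g , Y≤g*S)

  ≤-η*-codensity : ∀ {R J} (S : Fib (T₀ R)) (Y : Fib J) → Y ≤ η * codensity R S (J , Y)
  ≤-η*-codensity S Y = subst (Y ≤_) (sym (*-⋀ η _))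
    (⋀-greatest _ Y λ (g , Y≤g*S) →
      subst (Y ≤_) (trans (sym (*-resp-≈ S (#-∘-η g))) (*-∘ η (g #) S)) Y≤g*S)

  codensity-≤-T₁* : ∀ {I J} (S : Fib (T₀ J)) {X : Fib I} (f : I ⇒ J) →
                    X ≤ f * (η * S) → codensity J S (I , X) ≤ T₁ f * S
  codensity-≤-T₁* {I} {J} S {X} f X≤f*η*S = begin
    codensity J S (I , X)   ≤⟨ codensity-lower S (η ∘ f) X≤ηf*S ⟩
    ((η ∘ f) #) * S         ≤⟨ *-resp-≈-≤ S (η-∘-#≈T₁ f) ⟩
    T₁ f * S                ∎
    where
    open PosetReasoning (fibre-poset (T₀ I))
    X≤ηf*S : X ≤ (η ∘ f) * S
    X≤ηf*S = subst (X ≤_) (sym (*-∘ f η S)) X≤f*η*S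

  codensity-self-≤-μ* : ∀ {R} (S : Fib (T₀ R)) → codensity R S (T₀ R , S) ≤ μ * S
  codensity-self-≤-μ* {R} S = begin
    codensity R S (T₀ R , S)   ≤⟨ codensity-lower S id (Poset.reflexive (fibre-poset _) (sym (*-id S))) ⟩
    (id #) * S                 ≤⟨ *-resp-≈-≤ S id-#≈μ ⟩
    μ * S                      ∎
    where open PosetReasoning (fibre-poset (T₀ (T₀ R)))

  Cls-≤-η* : (X : EObj) (S : Cls X) → proj₂ X ≤ η * proj₁ S
  Cls-≤-η* (I , X) (S , S-closed) = subst (λ Z → X ≤ η * Z) (sym S-closed) (≤-η*-codensity S X)

module _ {o ℓ e c r : Level} {𝔹 : Category o ℓ e}
         (P : PosetalFibration 𝔹 c r) (𝒯 : Monad 𝔹) where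
  open Category 𝔹
  open PosetalFibration P
  open Monad 𝒯
  open Lifting P 𝒯
  open CodensityProperties P 𝒯
  open FibreProperties P

  closed-family-lift : (S : (X : EObj) → Cls X) →
                       (∀ X Y → proj₁ (S X) ≤ φ Y X (S Y)) → Lift
  closed-family-lift S S≤φ = record
    { Ṫ     = Ṫ
    ; Ṫ-hom = Ṫ-hom
    ; η-hom = λ {I} X → Cls-≤-η* (I , X) (S (I , X))
    ; μ-hom = μ-hom
    }
    where
    Ṫ : ∀ {I} → Fib I → Fib (T₀ I)
    Ṫ {I} X = proj₁ (S (I , X))

    Ṫ-hom : ∀ {I J} {X : Fib I} {Y : Fib J} (f : I ⇒ J) → X ≤ f * Y → Ṫ X ≤ T₁ f * Ṫ Y
    Ṫ-hom {I} {J} {X} {Y} f X≤f*Y = begin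
      Ṫ X                       ≤⟨ S≤φ (I , X) (J , Y) ⟩
      codensity J (Ṫ Y) (I , X) ≤⟨ codensity-≤-T₁* (Ṫ Y) f X≤f*η*ṪY ⟩
      T₁ f * Ṫ Y                ∎
      where
      open PosetReasoning (fibre-poset (T₀ I))
      X≤f*η*ṪY : X ≤ f * (η * Ṫ Y)
      X≤f*η*ṪY = Poset.trans (fibre-poset I) X≤f*Y (*-mono f (Cls-≤-η* (J , Y) (S (J , Y))))

    μ-hom : ∀ {I} (X : Fib I) → Ṫ (Ṫ X) ≤ μ * Ṫ X
    μ-hom {I} X = begin
      Ṫ (Ṫ X)                        ≤⟨ S≤φ (T₀ I , Ṫ X) (I , X) ⟩
      codensity I (Ṫ X) (T₀ I , Ṫ X) ≤⟨ codensity-self-≤-μ* (Ṫ X) ⟩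
      μ * Ṫ X                        ∎
      where open PosetReasoning (fibre-poset (T₀ (T₀ I)))

theorem8p11 : ∀ {o ℓ e c r v : Level} {𝔹 : Category o ℓ e}
                (P : PosetalFibration 𝔹 c r) (𝒯 : Monad 𝔹)
                (V : Set v) (rr : (X : Lifting.EObj P 𝒯) → V → Lifting.Cls P 𝒯 X) →
                Lifting.IsCone P 𝒯 rr → Lifting.PhiInequality P 𝒯 rr →
                Σ (V → Lifting.Lift P 𝒯) (λ m →
                  Lifting.Factors P 𝒯 rr m ×
                  (∀ (m′ : V → Lifting.Lift P 𝒯) → Lifting.Factors P 𝒯 rr m′ →
                    ∀ (x : V) (X : Lifting.EObj P 𝒯) →
                      Lifting.q P 𝒯 X (m′ x) ≡ Lifting.q P 𝒯 X (m x)))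
theorem8p11 P 𝒯 V rr _ r-φ-inequality =
  m , (λ X x → refl) , λ m′ r≡q∘m′ x X → sym (r≡q∘m′ X x)
  where
  m : V → Lifting.Lift P 𝒯
  m x = closed-family-lift P 𝒯 (λ X → rr X x) (λ X Y → r-φ-inequality X Y x)
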